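{- For all $k\ge 2$, $$\sum_{n\ge0}\frac{t^n}{[n]_{p,q}!}\sum_{\substack{(\sigma,w)\in C_k\wr S_n\\ \mathrm{dmch}(\sigma,w)=0}}q^{\mathrm{inv}(\sigma)}p^{\mathrm{coinv}(\sigma)}=\frac{k-1}{k-1+k\sum_{n\ge1}\frac{p^{\binom n2}(-(k-1)t)^n}{[n]_{p,q}!}}.$$
   Context: $C_k\wr S_n$ is identified with the set of pairs $(\sigma,w)$, $\sigma\in S_n$, $w=w_1\cdots w_n\in\{0,\dots,k-1\}^n$ (one empty element for $n=0$). $\mathrm{dmch}(\sigma,w)=|\{i\le n-1:\sigma_i<\sigma_{i+1},\ w_i\neq w_{i+1}\}|$. $\mathrm{inv}(\sigma)=|\{a<b:\sigma_a>\sigma_b\}|$, $\mathrm{coinv}(\sigma)=|\{a<b:\sigma_a<\sigma_b\}|$. $[n]_{p,q}=p^{n-1}+p^{n-2}q+\cdots+q^{n-1}$, $[n]_{p,q}!=[n]_{p,q}\cdots[1]_{p,q}$ ($[0]_{p,q}!=1$). -}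

module Defs where

open import Level using (Level)
open import Data.Bool using (Bool; true; false; if_then_else_; _∧_; not)
open import Data.Nat using (ℕ; zero; suc; _∸_; _<ᵇ_; _≡ᵇ_) renaming (_+_ to _+ℕ_)
open import Data.Fin using (Fin; toℕ)
open import Data.List using (List; []; _∷_; [_]; map; concatMap; filter; allFin; upTo)
open import Data.Vec using (Vec; toList) renaming ([] to []ᵥ; _∷_ to _∷ᵥ_)
open import Data.Bool using (T)
open import Data.Bool.Properties using (T?)
open import Data.Product using (_×_; _,_; proj₁; proj₂)
open import Data.Nat.Combinatorics using (_C_)
open import Algebra.Bundles using (CommutativeRing)

allVecs : (m n : ℕ) → List (Vec (Fin m) n)
allVecs m zero    = [ []ᵥ ]
allVecs m (suc n) = concatMap (λ i → map (i ∷ᵥ_) (allVecs m n)) (allFin m)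

elemᵇ : ℕ → List ℕ → Bool
elemᵇ x []       = false
elemᵇ x (y ∷ ys) = if x ≡ᵇ y then true else elemᵇ x ys

distinctᵇ : List ℕ → Bool
distinctᵇ []       = true
distinctᵇ (x ∷ xs) = not (elemᵇ x xs) ∧ distinctᵇ xs

-- one-line notation σ = σ_1 ⋯ σ_n (values in {0,…,n-1}, shifted by one)
line : ∀ {m n} → Vec (Fin m) n → List ℕ
line v = map toℕ (toList v)

-- S_n : the injective (hence bijective) maps [n] → [n], in one-line notation
perms : (n : ℕ) → List (Vec (Fin n) n)
perms n = filter (λ v → T? (distinctᵇ (line v))) (allVecs n n)

wreath : (k n : ℕ) → List (Vec (Fin n) n × Vec (Fin k) n)
wreath k n = concatMap (λ σ → map (σ ,_) (allVecs k n)) (perms n)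

count : (ℕ → Bool) → List ℕ → ℕ
count P []       = 0
count P (x ∷ xs) = (if P x then 1 else 0) +ℕ count P xs

invL : List ℕ → ℕ
invL []       = 0
invL (x ∷ xs) = count (λ y → y <ᵇ x) xs +ℕ invL xs

coinvL : List ℕ → ℕ
coinvL []       = 0
coinvL (x ∷ xs) = count (λ y → x <ᵇ y) xs +ℕ coinvL xs

dmchL : List ℕ → List ℕ → ℕ
dmchL (s₁ ∷ s₂ ∷ ss) (w₁ ∷ w₂ ∷ ws) =
  (if (s₁ <ᵇ s₂) ∧ not (w₁ ≡ᵇ w₂) then 1 else 0) +ℕ dmchL (s₂ ∷ ss) (w₂ ∷ ws)
dmchL _ _ = 0

dmch : ∀ {k n} → Vec (Fin n) n × Vec (Fin k) n → ℕ
dmch (σ , w) = dmchL (line σ) (line w)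

inv coinv : ∀ {n} → Vec (Fin n) n → ℕ
inv σ   = invL (line σ)
coinv σ = coinvL (line σ)

-- Algebra over an arbitrary commutative ring R (p, q ∈ R)
-- Formal power series in t over R are sequences ℕ → R of coefficients.

module _ {c ℓ : Level} (R : CommutativeRing c ℓ) where
  open CommutativeRing R

  sumR : List Carrier → Carrier
  sumR []       = 0#
  sumR (x ∷ xs) = x + sumR xs

  pow : Carrier → ℕ → Carrier
  pow x zero    = 1#
  pow x (suc n) = x * pow x n

  fromℕ : ℕ → Carrier
  fromℕ zero    = 0#
  fromℕ (suc n) = 1# + fromℕ n

  qint : Carrier → Carrier → ℕ → Carrier
  qint p q n = sumR (map (λ i → pow p (n ∸ 1 ∸ i) * pow q i) (upTo n))

  qfact : Carrier → Carrier → ℕ → Carrier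
  qfact p q zero    = 1#
  qfact p q (suc n) = qint p q (suc n) * qfact p q n

  dmchZeroSum : Carrier → Carrier → (k n : ℕ) → Carrier
  dmchZeroSum p q k n =
    sumR (map (λ x → if dmch x ≡ᵇ 0
                       then pow q (inv (proj₁ x)) * pow p (coinv (proj₁ x))
                       else 0#)
              (wreath k n))

  seriesMul : (ℕ → Carrier) → (ℕ → Carrier) → ℕ → Carrier
  seriesMul f g N = sumR (map (λ i → f i * g (N ∸ i)) (upTo (suc N)))

  const : Carrier → ℕ → Carrier
  const a zero    = a
  const a (suc _) = 0#

  -- LHS series:  Σ_n t^n / [n]! · dmchZeroSum  (finv n is the inverse of [n]!)
  lhsSeries : Carrier → Carrier → ℕ → (ℕ → Carrier) → ℕ → Carrier
  lhsSeries p q k finv n = finv n * dmchZeroSum p q k n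

  denomSeries : Carrier → Carrier → ℕ → (ℕ → Carrier) → ℕ → Carrier
  denomSeries p q k finv zero    = fromℕ (k ∸ 1)
  denomSeries p q k finv (suc m) =
    fromℕ k * (pow p ((suc m) C 2) * (pow (- fromℕ (k ∸ 1)) (suc m) * finv (suc m)))

-- Summing over the colourings first, a permutation σ contributes q ^ inv σ * p ^ coinv σ * k ^ (1 + des σ):
-- a colouring with dmch = 0 is constant along ascents and free at the other steps.  Splitting the
-- factor 1 of every ascent as k + (1 - k) and cutting off the maximal initial run of (1 - k)-marked
-- ascents, of length j, gives for the total a n over S_n, n ≥ 1,
--   a n = k * Σ_{j ≤ n} (1 - k) ^ j * p ^ (j C 2) * [n choose j]_{p,q} * a (n - j),
-- because the letters of such a run increase and are otherwise arbitrary.  Divided by [n]_{p,q}! this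
-- recurrence says exactly that the product of the two series has no coefficient beyond the constant one.
-- The recurrence is obtained by building permutations from the left while remembering the rank of
-- the previous letter among those still unused.

module Submission where

open import Defs
open import Level using (Level)
open import Algebra.Bundles using (CommutativeRing)
open import Data.Bool using (Bool; true; false; if_then_else_; _∧_; not; T)
open import Data.Bool.Properties using (T-≡)
import Data.Bool.Properties as Bool
import Data.Nat as ℕ
open import Data.Nat using (ℕ; zero; suc; _∸_; _<_; _≤_; s≤s; z≤n; _≤ᵇ_; _<ᵇ_; _≡ᵇ_)
import Data.Nat.Properties as ℕ
open import Data.Nat.Combinatorics using (_C_; nCk+nC[k+1]≡[n+1]C[k+1]; nC1≡n)
open import Algebra.Properties.CommutativeSemigroup ℕ.+-commutativeSemigroup
  using (x∙yz≈y∙xz)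
open import Data.Fin using (Fin; toℕ)
open import Data.Vec using (Vec) renaming ([] to []ᵥ; _∷_ to _∷ᵥ_)
open import Data.List
  using (List; []; _∷_; length; map; concatMap; filterᵇ; allFin; upTo; applyUpTo; tabulate; _++_)
open import Data.List.Properties
  using (filter-all; map-∘; map-concatMap; map-tabulate; length-upTo)
open import Data.List.Membership.Propositional using (_∈_)
open import Data.List.Relation.Unary.Any using (here; there)
open import Data.List.Relation.Unary.All as All using (All; []; _∷_)
open import Data.List.Relation.Unary.AllPairs as AllPairs using (AllPairs; []; _∷_)
import Data.List.Relation.Unary.AllPairs.Properties as AllPairs
open import Data.Product using (_×_; _,_)
open import Data.Sum using (inj₁; inj₂)
open import Data.Empty using (⊥-elim)
open import Function using (_∘_; Equivalence)
open import Relation.Binary.PropositionalEquality as ≡ using (_≡_; _≢_; module ≡-Reasoning)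
open import Relation.Binary.Definitions using (tri<; tri≈; tri>)

T⇒≡true : ∀ {b} → T b → b ≡ true
T⇒≡true = Equivalence.to T-≡

<⇒<ᵇ≡true : ∀ {x y} → x < y → (x <ᵇ y) ≡ true
<⇒<ᵇ≡true = T⇒≡true ∘ ℕ.<⇒<ᵇ

≥⇒<ᵇ≡false : ∀ {x y} → y ≤ x → (x <ᵇ y) ≡ false
≥⇒<ᵇ≡false {x} {y} y≤x with x <ᵇ y in eq
... | false = ≡.refl
... | true  = ⊥-elim (ℕ.<⇒≱ (ℕ.<ᵇ⇒< x y (Equivalence.from T-≡ eq)) y≤x)

≡ᵇ-refl : ∀ x → (x ≡ᵇ x) ≡ true
≡ᵇ-refl x = T⇒≡true (ℕ.≡⇒≡ᵇ x x ≡.refl)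

≢⇒≡ᵇ≡false : ∀ {x y} → x ≢ y → (x ≡ᵇ y) ≡ false
≢⇒≡ᵇ≡false {x} {y} x≢y with x ≡ᵇ y in eq
... | false = ≡.refl
... | true  = ⊥-elim (x≢y (ℕ.≡ᵇ⇒≡ x y (Equivalence.from T-≡ eq)))

≤⇒≤ᵇ≡true : ∀ {x y} → x ≤ y → (x ≤ᵇ y) ≡ true
≤⇒≤ᵇ≡true = T⇒≡true ∘ ℕ.≤⇒≤ᵇ

>⇒≤ᵇ≡false : ∀ {x y} → y < x → (x ≤ᵇ y) ≡ false
>⇒≤ᵇ≡false {x} {y} y<x with x ≤ᵇ y in eq
... | false = ≡.refl
... | true  = ⊥-elim (ℕ.<⇒≱ y<x (ℕ.≤ᵇ⇒≤ x y (Equivalence.from T-≡ eq)))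

suc≤ᵇsuc : ∀ a b → (suc a ≤ᵇ suc b) ≡ (a ≤ᵇ b)
suc≤ᵇsuc zero    b = ≡.refl
suc≤ᵇsuc (suc a) b = ≡.refl

≡ᵇ-sym : ∀ x y → (x ≡ᵇ y) ≡ (y ≡ᵇ x)
≡ᵇ-sym zero    zero    = ≡.refl
≡ᵇ-sym zero    (suc y) = ≡.refl
≡ᵇ-sym (suc x) zero    = ≡.refl
≡ᵇ-sym (suc x) (suc y) = ≡ᵇ-sym x y

Increasing : List ℕ → Set
Increasing = AllPairs _<_

Increasing-upTo : ∀ n → Increasing (upTo n)
Increasing-upTo n = AllPairs.applyUpTo⁺₁ (λ i → i) n (λ i<j _ → i<j)

delete : ℕ → List ℕ → List ℕ
delete x = filterᵇ (λ y → not (y ≡ᵇ x))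

Increasing-delete : ∀ x {L} → Increasing L → Increasing (delete x L)
Increasing-delete x = AllPairs.filter⁺ _

delete-head : ∀ {y L} → All (y <_) L → delete y (y ∷ L) ≡ L
delete-head {y} y<L rewrite ≡ᵇ-refl y =
  filter-all _ (All.map (λ y<z → Equivalence.from T-≡ (≡.cong not (≢⇒≡ᵇ≡false (ℕ.>⇒≢ y<z)))) y<L)

delete-there : ∀ {x y L} → y < x → delete x (y ∷ L) ≡ y ∷ delete x L
delete-there y<x rewrite ≢⇒≡ᵇ≡false (ℕ.<⇒≢ y<x) = ≡.refl

count-delete : ∀ P {L x} → Increasing L → x ∈ L →
  count P L ≡ (if P x then 1 else 0) ℕ.+ count P (delete x L)
count-delete P {y ∷ L} (y<L ∷ _) (here ≡.refl) rewrite delete-head y<L = ≡.refl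
count-delete P {y ∷ L} {x} (y<L ∷ inc) (there x∈L)
  rewrite delete-there {L = L} (All.lookup y<L x∈L) | count-delete P inc x∈L =
    x∙yz≈y∙xz (if P y then 1 else 0) (if P x then 1 else 0) _

count-const-true : ∀ L → count (λ _ → true) L ≡ length L
count-const-true []      = ≡.refl
count-const-true (x ∷ L) = ≡.cong suc (count-const-true L)

length-delete : ∀ {L x} → Increasing L → x ∈ L → length L ≡ suc (length (delete x L))
length-delete {L} {x} inc x∈L = begin
  length L                                 ≡⟨ ≡.sym (count-const-true L) ⟩
  count (λ _ → true) L                     ≡⟨ count-delete (λ _ → true) inc x∈L ⟩
  suc (count (λ _ → true) (delete x L))    ≡⟨ ≡.cong suc (count-const-true (delete x L)) ⟩
  suc (length (delete x L))                ∎
  where open ≡-Reasoning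

count-none : ∀ P {L} → All (λ z → P z ≡ false) L → count P L ≡ 0
count-none P []                 = ≡.refl
count-none P {z ∷ L} (Pz ∷ PL) rewrite Pz = count-none P PL

count-every : ∀ P {L} → All (λ z → P z ≡ true) L → count P L ≡ length L
count-every P []                 = ≡.refl
count-every P {z ∷ L} (Pz ∷ PL) rewrite Pz = ≡.cong suc (count-every P PL)

below above atMost : ℕ → List ℕ → ℕ
below  x = count (λ y → y <ᵇ x)
above  x = count (λ y → x <ᵇ y)
atMost x = count (λ y → not (x <ᵇ y))

atMost-delete : ∀ x L → atMost x (delete x L) ≡ below x L
atMost-delete x []      = ≡.refl
atMost-delete x (y ∷ L) with ℕ.<-cmp y x
... | tri< y<x _ _
  rewrite ≢⇒≡ᵇ≡false (ℕ.<⇒≢ y<x) | ≥⇒<ᵇ≡false (ℕ.<⇒≤ y<x) | <⇒<ᵇ≡true y<x =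
    ≡.cong suc (atMost-delete x L)
... | tri≈ _ ≡.refl _ rewrite ≡ᵇ-refl y | ≥⇒<ᵇ≡false (ℕ.≤-refl {y}) = atMost-delete x L
... | tri> _ _ x<y
  rewrite ≢⇒≡ᵇ≡false (ℕ.>⇒≢ x<y) | <⇒<ᵇ≡true x<y | ≥⇒<ᵇ≡false (ℕ.<⇒≤ x<y) =
    atMost-delete x L

below-head : ∀ {y L} → All (y <_) L → below y (y ∷ L) ≡ 0
below-head {y} y<L rewrite ≥⇒<ᵇ≡false (ℕ.≤-refl {y}) =
  count-none _ (All.map (≥⇒<ᵇ≡false ∘ ℕ.<⇒≤) y<L)

below+above : ∀ {L x} → Increasing L → x ∈ L → suc (below x L ℕ.+ above x L) ≡ length L
below+above {y ∷ L} (y<L ∷ _) (here ≡.refl)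
  rewrite below-head y<L | ≥⇒<ᵇ≡false (ℕ.≤-refl {y}) =
    ≡.cong suc (count-every _ (All.map <⇒<ᵇ≡true y<L))
below+above {y ∷ L} {x} (y<L ∷ inc) (there x∈L)
  rewrite <⇒<ᵇ≡true (All.lookup y<L x∈L) | ≥⇒<ᵇ≡false (ℕ.<⇒≤ (All.lookup y<L x∈L)) =
    ≡.cong suc (below+above inc x∈L)

<ᵇ≡atMost≤ᵇbelow : ∀ b {L x} → Increasing L → x ∈ L → (b <ᵇ x) ≡ (atMost b L ≤ᵇ below x L)
<ᵇ≡atMost≤ᵇbelow b {y ∷ L} {x} (y<L ∷ inc) x∈ with ℕ.<-cmp b y
... | tri< b<y _ _
  rewrite <⇒<ᵇ≡true b<y
        | count-none (λ z → not (b <ᵇ z)) (All.map (λ y<z → ≡.cong not (<⇒<ᵇ≡true (ℕ.<-trans b<y y<z))) y<L) =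
    <⇒<ᵇ≡true (b<x x∈)
  where
  b<x : x ∈ y ∷ L → b < x
  b<x (here ≡.refl)  = b<y
  b<x (there x∈L) = ℕ.<-trans b<y (All.lookup y<L x∈L)
... | tri≈ _ ≡.refl _ rewrite ≥⇒<ᵇ≡false (ℕ.≤-refl {b}) = atHead x∈
  where
  atHead : x ∈ b ∷ L → (b <ᵇ x) ≡ (suc (atMost b L) ≤ᵇ below x (b ∷ L))
  atHead (here ≡.refl) rewrite below-head y<L | ≥⇒<ᵇ≡false (ℕ.≤-refl {b}) = ≡.refl
  atHead (there x∈L)
    rewrite <⇒<ᵇ≡true (All.lookup y<L x∈L)
          | count-none (λ z → not (b <ᵇ z)) (All.map (≡.cong not ∘ <⇒<ᵇ≡true) y<L) = ≡.refl
... | tri> _ _ y<b rewrite ≥⇒<ᵇ≡false (ℕ.<⇒≤ y<b) = pastHead x∈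
  where
  pastHead : x ∈ y ∷ L → (b <ᵇ x) ≡ (suc (atMost b L) ≤ᵇ below x (y ∷ L))
  pastHead (here ≡.refl) rewrite below-head y<L | ≥⇒<ᵇ≡false (ℕ.<⇒≤ y<b) = ≡.refl
  pastHead (there x∈L) rewrite <⇒<ᵇ≡true (All.lookup y<L x∈L) =
    ≡.trans (<ᵇ≡atMost≤ᵇbelow b inc x∈L) (≡.sym (suc≤ᵇsuc (atMost b L) (below x L)))

avoid : List ℕ → ℕ → Bool
avoid E y = not (elemᵇ y E)

allAvoid : List ℕ → List ℕ → Bool
allAvoid E []      = true
allAvoid E (y ∷ l) = avoid E y ∧ allAvoid E l

distinctAvoiding : List ℕ → List ℕ → Bool
distinctAvoiding E l = distinctᵇ l ∧ allAvoid E l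

distinctAvoiding-[] : ∀ l → distinctAvoiding [] l ≡ distinctᵇ l
distinctAvoiding-[] l = ≡.trans (≡.cong (distinctᵇ l ∧_) (allAvoid-[] l)) (Bool.∧-identityʳ _)
  where
  allAvoid-[] : ∀ l → allAvoid [] l ≡ true
  allAvoid-[] []      = ≡.refl
  allAvoid-[] (y ∷ l) = allAvoid-[] l

allAvoid-∷ : ∀ x E l → allAvoid (x ∷ E) l ≡ not (elemᵇ x l) ∧ allAvoid E l
allAvoid-∷ x E []      = ≡.refl
allAvoid-∷ x E (y ∷ l) rewrite ≡ᵇ-sym y x | allAvoid-∷ x E l with x ≡ᵇ y
... | true  = ≡.refl
... | false = ∧-swap (not (elemᵇ y E)) (not (elemᵇ x l)) (allAvoid E l)
  where
  ∧-swap : ∀ a b c → a ∧ (b ∧ c) ≡ b ∧ (a ∧ c)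
  ∧-swap true  b c = ≡.refl
  ∧-swap false true  c = ≡.refl
  ∧-swap false false c = ≡.refl

distinctAvoiding-∷ : ∀ E x l →
  distinctAvoiding E (x ∷ l) ≡ avoid E x ∧ distinctAvoiding (x ∷ E) l
distinctAvoiding-∷ E x l rewrite allAvoid-∷ x E l =
  ∧-shuffle (not (elemᵇ x l)) (distinctᵇ l) (avoid E x) (allAvoid E l)
  where
  ∧-shuffle : ∀ a b c d → (a ∧ b) ∧ (c ∧ d) ≡ c ∧ (b ∧ (a ∧ d))
  ∧-shuffle true  true  true  d = ≡.refl
  ∧-shuffle true  true  false d = ≡.refl
  ∧-shuffle true  false c     d = ≡.sym (Bool.∧-zeroʳ c)
  ∧-shuffle false b     c     d = ≡.sym (≡.trans (≡.cong (c ∧_) (Bool.∧-zeroʳ b)) (Bool.∧-zeroʳ c))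

delete-avoiding : ∀ x E xs → delete x (filterᵇ (avoid E) xs) ≡ filterᵇ (avoid (x ∷ E)) xs
delete-avoiding x E []       = ≡.refl
delete-avoiding x E (y ∷ xs) with elemᵇ y E
... | true  with y ≡ᵇ x
...   | true  = delete-avoiding x E xs
...   | false = delete-avoiding x E xs
delete-avoiding x E (y ∷ xs) | false with y ≡ᵇ x
...   | true  = delete-avoiding x E xs
...   | false = ≡.cong (y ∷_) (delete-avoiding x E xs)

filterᵇ-avoid-[] : ∀ xs → filterᵇ (avoid []) xs ≡ xs
filterᵇ-avoid-[] []       = ≡.refl
filterᵇ-avoid-[] (x ∷ xs) = ≡.cong (x ∷_) (filterᵇ-avoid-[] xs)

module RingSums {c ℓ : Level} (R : CommutativeRing c ℓ) where
  open CommutativeRing R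
  open import Relation.Binary.Reasoning.Setoid setoid
  open import Algebra.Solver.Ring.NaturalCoefficients.Default commutativeSemiring
    using (solve; _:=_; _:+_; _:*_)

  sumR-cong-∈ : ∀ {a} {A : Set a} (xs : List A) {f g : A → Carrier} →
    (∀ x → x ∈ xs → f x ≈ g x) → sumR R (map f xs) ≈ sumR R (map g xs)
  sumR-cong-∈ []       f≈g = refl
  sumR-cong-∈ (x ∷ xs) f≈g = +-cong (f≈g x (here ≡.refl)) (sumR-cong-∈ xs (λ y y∈ → f≈g y (there y∈)))

  sumR-cong : ∀ {a} {A : Set a} (xs : List A) {f g : A → Carrier} →
    (∀ x → f x ≈ g x) → sumR R (map f xs) ≈ sumR R (map g xs)
  sumR-cong xs f≈g = sumR-cong-∈ xs (λ x _ → f≈g x)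

  sumR-++ : ∀ xs ys → sumR R (xs ++ ys) ≈ sumR R xs + sumR R ys
  sumR-++ []       ys = sym (+-identityˡ _)
  sumR-++ (x ∷ xs) ys = trans (+-cong refl (sumR-++ xs ys)) (sym (+-assoc _ _ _))

  sumR-concatMap : ∀ {a b} {A : Set a} {B : Set b} (h : B → Carrier) (f : A → List B) xs →
    sumR R (map h (concatMap f xs)) ≈ sumR R (map (λ x → sumR R (map h (f x))) xs)
  sumR-concatMap h f xs = trans (reflexive (≡.cong (sumR R) (map-concatMap h f xs))) (go xs)
    where
    go : ∀ xs → sumR R (concatMap (λ x → map h (f x)) xs) ≈ sumR R (map (λ x → sumR R (map h (f x))) xs)
    go []       = refl
    go (x ∷ xs) = trans (sumR-++ (map h (f x)) _) (+-cong refl (go xs))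

  sumR-map-map : ∀ {a b} {A : Set a} {B : Set b} (h : B → Carrier) (g : A → B) xs →
    sumR R (map h (map g xs)) ≈ sumR R (map (λ x → h (g x)) xs)
  sumR-map-map h g xs = reflexive (≡.sym (≡.cong (sumR R) (map-∘ xs)))

  sumR-≈0 : ∀ {a} {A : Set a} (xs : List A) {f : A → Carrier} → (∀ x → f x ≈ 0#) → sumR R (map f xs) ≈ 0#
  sumR-≈0 []       f≈0 = refl
  sumR-≈0 (x ∷ xs) f≈0 = trans (+-cong (f≈0 x) (sumR-≈0 xs f≈0)) (+-identityˡ _)

  sumR-*ˡ : ∀ {a} {A : Set a} (xs : List A) (f : A → Carrier) y →
    y * sumR R (map f xs) ≈ sumR R (map (λ x → y * f x) xs)
  sumR-*ˡ []       f y = zeroʳ y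
  sumR-*ˡ (x ∷ xs) f y = trans (distribˡ y _ _) (+-cong refl (sumR-*ˡ xs f y))

  sumR-filterᵇ : ∀ {a} {A : Set a} (b : A → Bool) (h : A → Carrier) xs →
    sumR R (map h (filterᵇ b xs)) ≈ sumR R (map (λ x → if b x then h x else 0#) xs)
  sumR-filterᵇ b h []       = refl
  sumR-filterᵇ b h (x ∷ xs) with b x
  ... | true  = +-cong refl (sumR-filterᵇ b h xs)
  ... | false = trans (sumR-filterᵇ b h xs) (sym (+-identityˡ _))

  sumTo : ℕ → (ℕ → Carrier) → Carrier
  sumTo zero    f = 0#
  sumTo (suc n) f = f 0 + sumTo n (λ i → f (suc i))

  sumR-applyUpTo : (g : ℕ → Carrier) (f : ℕ → ℕ) (n : ℕ) → sumR R (map g (applyUpTo f n)) ≈ sumTo n (λ i → g (f i))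
  sumR-applyUpTo g f zero    = refl
  sumR-applyUpTo g f (suc n) = +-cong refl (sumR-applyUpTo g (λ i → f (suc i)) n)

  sumR-upTo : (g : ℕ → Carrier) (n : ℕ) → sumR R (map g (upTo n)) ≈ sumTo n g
  sumR-upTo g = sumR-applyUpTo g (λ i → i)

  sumR-allFin : ∀ n (g : ℕ → Carrier) → sumR R (map (λ i → g (toℕ i)) (allFin n)) ≈ sumTo n g
  sumR-allFin n g = trans (reflexive (≡.cong (sumR R) (map-tabulate {n = n} (λ i → i) (λ i → g (toℕ i))))) (go n g)
    where
    go : ∀ n (g : ℕ → Carrier) → sumR R (tabulate (λ (i : Fin n) → g (toℕ i))) ≈ sumTo n g
    go zero    g = refl
    go (suc n) g = +-cong refl (go n (λ i → g (suc i)))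

  sumTo-cong< : ∀ n {f g : ℕ → Carrier} → (∀ i → i < n → f i ≈ g i) → sumTo n f ≈ sumTo n g
  sumTo-cong< zero    f≈g = refl
  sumTo-cong< (suc n) f≈g = +-cong (f≈g 0 (s≤s z≤n)) (sumTo-cong< n (λ i i<n → f≈g (suc i) (s≤s i<n)))

  sumTo-cong : ∀ n {f g : ℕ → Carrier} → (∀ i → f i ≈ g i) → sumTo n f ≈ sumTo n g
  sumTo-cong n f≈g = sumTo-cong< n (λ i _ → f≈g i)

  sumTo-≈0 : ∀ n (f : ℕ → Carrier) → (∀ i → i < n → f i ≈ 0#) → sumTo n f ≈ 0#
  sumTo-≈0 zero    f f≈0 = refl
  sumTo-≈0 (suc n) f f≈0 =
    trans (+-cong (f≈0 0 (s≤s z≤n)) (sumTo-≈0 n _ (λ i i<n → f≈0 (suc i) (s≤s i<n)))) (+-identityˡ _)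

  sumTo-+ : ∀ n (f g : ℕ → Carrier) → sumTo n (λ i → f i + g i) ≈ sumTo n f + sumTo n g
  sumTo-+ zero    f g = sym (+-identityˡ _)
  sumTo-+ (suc n) f g = trans (+-cong refl (sumTo-+ n _ _))
    (solve 4 (λ a b x y → (a :+ b) :+ (x :+ y) := (a :+ x) :+ (b :+ y)) refl _ _ _ _)

  sumTo-*ˡ : ∀ n (f : ℕ → Carrier) a → a * sumTo n f ≈ sumTo n (λ i → a * f i)
  sumTo-*ˡ zero    f a = zeroʳ a
  sumTo-*ˡ (suc n) f a = trans (distribˡ a _ _) (+-cong refl (sumTo-*ˡ n _ a))

  sumTo-*ʳ : ∀ n (f : ℕ → Carrier) a → sumTo n f * a ≈ sumTo n (λ i → f i * a)
  sumTo-*ʳ n f a = trans (*-comm _ _) (trans (sumTo-*ˡ n f a) (sumTo-cong n (λ i → *-comm _ _)))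

  sumTo-snoc : ∀ n (f : ℕ → Carrier) → sumTo (suc n) f ≈ sumTo n f + f n
  sumTo-snoc zero    f = trans (+-identityʳ _) (sym (+-identityˡ _))
  sumTo-snoc (suc n) f = trans (+-cong refl (sumTo-snoc n _)) (sym (+-assoc _ _ _))

  sumTo-split : ∀ a b (f : ℕ → Carrier) → sumTo (a ℕ.+ b) f ≈ sumTo a f + sumTo b (λ i → f (a ℕ.+ i))
  sumTo-split zero    b f = sym (+-identityˡ _)
  sumTo-split (suc a) b f = trans (+-cong refl (sumTo-split a b _)) (sym (+-assoc _ _ _))

  sumTo-extend : ∀ m M (f : ℕ → Carrier) → m ≤ M → (∀ j → m ≤ j → f j ≈ 0#) → sumTo m f ≈ sumTo M f
  sumTo-extend m M f m≤M f≈0 = begin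
    sumTo m f                                         ≈⟨ sym (+-identityʳ _) ⟩
    sumTo m f + 0#                                    ≈⟨ +-cong refl (sym (sumTo-≈0 (M ∸ m) _ (λ i _ → f≈0 (m ℕ.+ i) (ℕ.m≤m+n m i)))) ⟩
    sumTo m f + sumTo (M ∸ m) (λ i → f (m ℕ.+ i))       ≈⟨ sym (sumTo-split m (M ∸ m) f) ⟩
    sumTo (m ℕ.+ (M ∸ m)) f                             ≡⟨ ≡.cong (λ k → sumTo k f) (ℕ.m+[n∸m]≡n m≤M) ⟩
    sumTo M f                                         ∎

  sumTo-swap : ∀ m n (f : ℕ → ℕ → Carrier) →
    sumTo m (λ i → sumTo n (λ j → f i j)) ≈ sumTo n (λ j → sumTo m (λ i → f i j))
  sumTo-swap zero    n f = sym (sumTo-≈0 n _ (λ _ _ → refl))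
  sumTo-swap (suc m) n f =
    trans (+-cong refl (sumTo-swap m n (λ i j → f (suc i) j))) (sym (sumTo-+ n _ _))

  sumTo-reverse : ∀ n (f : ℕ → Carrier) → sumTo n f ≈ sumTo n (λ i → f (n ∸ suc i))
  sumTo-reverse zero    f = refl
  sumTo-reverse (suc n) f = begin
    f 0 + sumTo n (λ i → f (suc i))
      ≈⟨ +-comm _ _ ⟩
    sumTo n (λ i → f (suc i)) + f 0
      ≈⟨ +-cong (sumTo-reverse n _) refl ⟩
    sumTo n (λ i → f (suc (n ∸ suc i))) + f 0
      ≈⟨ +-cong (sumTo-cong< n (λ i i<n → reflexive (≡.cong f (≡.sym (ℕ.+-∸-assoc 1 i<n)))))
                (reflexive (≡.cong f (≡.sym (ℕ.n∸n≡0 n)))) ⟩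
    sumTo n (λ i → f (suc n ∸ suc i)) + f (suc n ∸ suc n)
      ≈⟨ sym (sumTo-snoc n _) ⟩
    sumTo (suc n) (λ i → f (suc n ∸ suc i)) ∎

  sumTo-const : ∀ n x → sumTo n (λ _ → x) ≈ fromℕ R n * x
  sumTo-const zero    x = sym (zeroˡ x)
  sumTo-const (suc n) x = trans (+-cong (sym (*-identityˡ x)) (sumTo-const n x)) (sym (distribʳ x 1# (fromℕ R n)))

  sumTo-indicator : ∀ n d x → d < n → sumTo n (λ i → if not (d ≡ᵇ i) then 0# else x) ≈ x
  sumTo-indicator (suc n) zero    x _         = trans (+-cong refl (sumTo-≈0 n _ (λ _ _ → refl))) (+-identityʳ x)
  sumTo-indicator (suc n) (suc d) x (s≤s d<n) = trans (+-identityˡ _) (sumTo-indicator n d x d<n)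

  pow-+ : ∀ x m n → pow R x (m ℕ.+ n) ≈ pow R x m * pow R x n
  pow-+ x zero    n = sym (*-identityˡ _)
  pow-+ x (suc m) n = trans (*-cong refl (pow-+ x m n)) (sym (*-assoc _ _ _))

module Recurrences {c ℓ : Level} (R : CommutativeRing c ℓ) (p q K : CommutativeRing.Carrier R) where
  open CommutativeRing R
  open RingSums R
  open import Relation.Binary.Reasoning.Setoid setoid
  open import Algebra.Solver.Ring.NaturalCoefficients.Default commutativeSemiring
    using (solve; _:=_; _:+_; _:*_; con)

  infixr 8 _^_
  _^_ : Carrier → ℕ → Carrier
  x ^ n = pow R x n

  [_] [_]! : ℕ → Carrier
  [ n ]  = qint R p q n
  [ n ]! = qfact R p q n

  -- weightAfter n l sums q ^ inv * p ^ coinv * K ^ (non-ascents) over the arrangements of n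
  -- letters placed after a letter greater than exactly l of them, so that a first letter of
  -- rank i makes an ascent iff l ≤ i; weight n charges K for the first letter instead.
  stepFactor : ℕ → ℕ → Carrier
  stepFactor l i = if l ≤ᵇ i then 1# else K

  weightAfter : ℕ → ℕ → Carrier
  weightAfter zero    l = 1#
  weightAfter (suc n) l = sumTo (suc n) (λ i → (q ^ i * p ^ (n ∸ i)) * (stepFactor l i * weightAfter n i))

  weight : ℕ → Carrier
  weight zero    = 1#
  weight (suc n) = K * sumTo (suc n) (λ i → (q ^ i * p ^ (n ∸ i)) * weightAfter n i)

  -- p ^ (j C 2) times the (p,q)-binomial coefficient, see pqChoose*qfact.
  pqChoose : ℕ → ℕ → Carrier
  pqChoose h zero    = 1#
  pqChoose h (suc j) = sumTo h (λ r → (q ^ r * p ^ (h ∸ suc r)) * (q ^ (r ℕ.* j) * pqChoose (h ∸ suc r) j))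

  weight-suc : ∀ n → weight (suc n) ≈ K * weightAfter (suc n) 0
  weight-suc n = *-congˡ (sumTo-cong (suc n) {λ i → w i * weightAfter n i} (λ i → *-congˡ (sym (*-identityˡ _))))
    where
    w : ℕ → Carrier
    w i = q ^ i * p ^ (n ∸ i)

  pqChoose-vanishes : ∀ {m j} → m < j → pqChoose m j ≈ 0#
  pqChoose-vanishes {m} {suc j} (s≤s m≤j) = sumTo-≈0 m _ (λ r r<m →
    trans (*-cong refl (*-cong refl (pqChoose-vanishes (ℕ.<-≤-trans (ℕ.∸-monoʳ-< {m} {suc r} {0} (s≤s z≤n) r<m) m≤j))))
          (trans (*-cong refl (zeroʳ _)) (zeroʳ _)))

  qint-split : ∀ j h → j ≤ h → p ^ (h ∸ j) * [ suc j ] + q ^ suc j * [ h ∸ j ] ≈ [ suc h ]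
  qint-split j h j≤h = begin
    p ^ (h ∸ j) * [ suc j ] + q ^ suc j * [ h ∸ j ]
      ≈⟨ +-cong (*-congˡ (qint≈sumTo (suc j))) (*-congˡ (qint≈sumTo (h ∸ j))) ⟩
    p ^ (h ∸ j) * sumTo (suc j) (λ i → p ^ (j ∸ i) * q ^ i) + q ^ suc j * sumTo (h ∸ j) (λ i → p ^ (h ∸ j ∸ 1 ∸ i) * q ^ i)
      ≈⟨ +-cong (trans (sumTo-*ˡ (suc j) (λ i → p ^ (j ∸ i) * q ^ i) _) (sumTo-cong< (suc j) low))
                (trans (sumTo-*ˡ (h ∸ j) (λ i → p ^ (h ∸ j ∸ 1 ∸ i) * q ^ i) _) (sumTo-cong (h ∸ j) high)) ⟩
    sumTo (suc j) (λ i → p ^ (h ∸ i) * q ^ i) + sumTo (h ∸ j) (λ i → p ^ (h ∸ (suc j ℕ.+ i)) * q ^ (suc j ℕ.+ i))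
      ≈⟨ sym (sumTo-split (suc j) (h ∸ j) (λ i → p ^ (h ∸ i) * q ^ i)) ⟩
    sumTo (suc j ℕ.+ (h ∸ j)) (λ i → p ^ (h ∸ i) * q ^ i)
      ≡⟨ ≡.cong (λ k → sumTo (suc k) (λ i → p ^ (h ∸ i) * q ^ i)) (ℕ.m+[n∸m]≡n j≤h) ⟩
    sumTo (suc h) (λ i → p ^ (h ∸ i) * q ^ i)
      ≈⟨ sym (qint≈sumTo (suc h)) ⟩
    [ suc h ] ∎
    where
    qint≈sumTo : ∀ n → [ n ] ≈ sumTo n (λ i → p ^ (n ∸ 1 ∸ i) * q ^ i)
    qint≈sumTo n = sumR-upTo (λ i → p ^ (n ∸ 1 ∸ i) * q ^ i) n
    low : ∀ i → i < suc j → p ^ (h ∸ j) * (p ^ (j ∸ i) * q ^ i) ≈ p ^ (h ∸ i) * q ^ i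
    low i (s≤s i≤j) = trans (sym (*-assoc _ _ _)) (*-congʳ (trans (sym (pow-+ p (h ∸ j) (j ∸ i)))
      (reflexive (≡.cong (p ^_) (≡.trans (ℕ.+-comm (h ∸ j) (j ∸ i))
        (≡.trans (≡.sym (ℕ.+-∸-comm (h ∸ j) i≤j)) (≡.cong (_∸ i) (ℕ.m+[n∸m]≡n j≤h))))))))
    high : ∀ i → q ^ suc j * (p ^ (h ∸ j ∸ 1 ∸ i) * q ^ i) ≈ p ^ (h ∸ (suc j ℕ.+ i)) * q ^ (suc j ℕ.+ i)
    high i = trans (solve 3 (λ a b x → a :* (b :* x) := b :* (a :* x)) refl _ _ _)
      (*-cong (reflexive (≡.cong (p ^_) h∸j∸1∸i)) (sym (pow-+ q (suc j) i)))
      where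
      h∸j∸1∸i : h ∸ j ∸ 1 ∸ i ≡ h ∸ (suc j ℕ.+ i)
      h∸j∸1∸i = ≡.trans (ℕ.∸-+-assoc (h ∸ j) 1 i) (≡.trans (ℕ.∸-+-assoc h j (suc i)) (≡.cong (h ∸_) (ℕ.+-suc j i)))

  pqChoose-suc : ∀ h j → pqChoose (suc h) (suc j) ≈ p ^ h * pqChoose h j + q ^ suc j * pqChoose h (suc j)
  pqChoose-suc h j =
    +-cong (*-cong (*-identityˡ _) (*-identityˡ _)) (trans (sumTo-cong h pull-q) (sym (sumTo-*ˡ h _ _)))
    where
    pull-q : ∀ r → (q ^ suc r * p ^ (h ∸ suc r)) * (q ^ (j ℕ.+ r ℕ.* j) * pqChoose (h ∸ suc r) j)
                 ≈ q ^ suc j * ((q ^ r * p ^ (h ∸ suc r)) * (q ^ (r ℕ.* j) * pqChoose (h ∸ suc r) j))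
    pull-q r = trans (*-congˡ (*-congʳ (pow-+ q j (r ℕ.* j))))
      (solve 6 (λ qq qr pe qj qrj t → ((qq :* qr) :* pe) :* ((qj :* qrj) :* t) := (qq :* qj) :* ((qr :* pe) :* (qrj :* t)))
        refl q (q ^ r) (p ^ (h ∸ suc r)) (q ^ j) (q ^ (r ℕ.* j)) (pqChoose (h ∸ suc r) j))

  pqChoose*qfact : ∀ h j → j ≤ h → pqChoose h j * ([ j ]! * [ h ∸ j ]!) ≈ p ^ (j C 2) * [ h ]!
  pqChoose*qfact h       zero    _         = trans (*-identityˡ _) (trans (*-identityˡ _) (sym (*-identityˡ _)))
  pqChoose*qfact (suc h) (suc j) (s≤s j≤h) = begin
    pqChoose (suc h) (suc j) * ((Qs * [ j ]!) * [ h ∸ j ]!)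
      ≈⟨ *-congʳ (pqChoose-suc h j) ⟩
    (p ^ h * pqChoose h j + qsj * pqChoose h (suc j)) * ((Qs * [ j ]!) * [ h ∸ j ]!)
      ≈⟨ distribʳ _ _ _ ⟩
    (p ^ h * pqChoose h j) * ((Qs * [ j ]!) * [ h ∸ j ]!) + (qsj * pqChoose h (suc j)) * ((Qs * [ j ]!) * [ h ∸ j ]!)
      ≈⟨ +-cong keep-first choose-next ⟩
    (pj * pd) * Qs * (Cj * F) + qsj * Qd * (pj * Cj * F)
      ≈⟨ solve 7 (λ pj pd Qs Cj F qsj Qd → (pj :* pd) :* Qs :* (Cj :* F) :+ qsj :* Qd :* (pj :* Cj :* F)
                   := (pj :* Cj) :* ((pd :* Qs :+ qsj :* Qd) :* F)) refl pj pd Qs Cj F qsj Qd ⟩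
    (pj * Cj) * ((pd * Qs + qsj * Qd) * F)
      ≈⟨ *-cong (sym p^C[1+j]) (*-congʳ (qint-split j h j≤h)) ⟩
    p ^ (suc j C 2) * ([ suc h ] * F) ∎
    where
    pj = p ^ j
    pd = p ^ (h ∸ j)
    Cj = p ^ (j C 2)
    qsj = q ^ suc j
    Qs = [ suc j ]
    Qd = [ h ∸ j ]
    F = [ h ]!
    p^h : p ^ h ≈ pj * pd
    p^h = trans (reflexive (≡.cong (p ^_) (≡.sym (ℕ.m+[n∸m]≡n j≤h)))) (pow-+ p j (h ∸ j))
    p^C[1+j] : p ^ (suc j C 2) ≈ pj * Cj
    p^C[1+j] = trans (reflexive (≡.cong (p ^_) [1+j]C2)) (pow-+ p j (j C 2))
      where
      [1+j]C2 : suc j C 2 ≡ j ℕ.+ j C 2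
      [1+j]C2 = ≡.trans (≡.sym (nCk+nC[k+1]≡[n+1]C[k+1] j 1)) (≡.cong (ℕ._+ j C 2) (nC1≡n j))
    keep-first : (p ^ h * pqChoose h j) * ((Qs * [ j ]!) * [ h ∸ j ]!) ≈ (pj * pd) * Qs * (Cj * F)
    keep-first = trans (solve 5 (λ a t s f g → (a :* t) :* ((s :* f) :* g) := a :* s :* (t :* (f :* g)))
                          refl (p ^ h) (pqChoose h j) Qs ([ j ]!) ([ h ∸ j ]!))
      (*-cong (*-congʳ p^h) (pqChoose*qfact h j j≤h))
    choose-next : (qsj * pqChoose h (suc j)) * ((Qs * [ j ]!) * [ h ∸ j ]!) ≈ qsj * Qd * (pj * Cj * F)
    choose-next with ℕ.m≤n⇒m<n∨m≡n j≤h
    ... | inj₁ j<h = go (ℕ.+-∸-assoc 1 j<h)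
      where
      go : ∀ {d} → d ≡ suc (h ∸ suc j) → (qsj * pqChoose h (suc j)) * ((Qs * [ j ]!) * [ d ]!) ≈ qsj * [ d ] * (pj * Cj * F)
      go ≡.refl = trans (solve 6 (λ a t s f g b → (a :* t) :* ((s :* f) :* (b :* g)) := a :* b :* (t :* ((s :* f) :* g)))
                           refl qsj (pqChoose h (suc j)) Qs ([ j ]!) ([ h ∸ suc j ]!) ([ suc (h ∸ suc j) ]))
                    (*-congˡ (trans (pqChoose*qfact h (suc j) j<h) (*-congʳ p^C[1+j])))
    ... | inj₂ ≡.refl =
      trans (*-congʳ (trans (*-congˡ (pqChoose-vanishes (ℕ.n<1+n j))) (zeroʳ _)))
        (trans (zeroˡ _) (sym (trans (*-congʳ (trans (*-congˡ (reflexive (≡.cong [_] (ℕ.n∸n≡0 j)))) (zeroʳ _))) (zeroˡ _))))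

  module _ (cc : Carrier) (K+cc≈1 : K + cc ≈ 1#) where

    ascentCorrection : ℕ → ℕ → Carrier
    ascentCorrection l i = if l ≤ᵇ i then cc else 0#

    stepFactor-split : ∀ l i → stepFactor l i ≈ K + ascentCorrection l i
    stepFactor-split l i with l ≤ᵇ i
    ... | true  = sym K+cc≈1
    ... | false = sym (+-identityʳ K)

    ascentCorrection-≥ : ∀ l r x → ascentCorrection l (l ℕ.+ r) * x ≈ cc * x
    ascentCorrection-≥ l r x rewrite ≤⇒≤ᵇ≡true (ℕ.m≤m+n l r) = refl

    ascentCorrection-< : ∀ l i x → i < l → ascentCorrection l i * x ≈ 0#
    ascentCorrection-< l i x i<l rewrite >⇒≤ᵇ≡false i<l = zeroˡ x

    weightAfter-suc : ∀ n l → l ≤ suc n → weightAfter (suc n) l ≈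
      weight (suc n) + cc * sumTo (suc n ∸ l) (λ r → (q ^ (l ℕ.+ r) * p ^ (n ∸ (l ℕ.+ r))) * weightAfter n (l ℕ.+ r))
    weightAfter-suc n l l≤ = begin
      sumTo (suc n) (λ i → w i * (stepFactor l i * weightAfter n i))
        ≈⟨ sumTo-cong (suc n) split ⟩
      sumTo (suc n) (λ i → K * (w i * weightAfter n i) + g i)
        ≈⟨ sumTo-+ (suc n) (λ i → K * (w i * weightAfter n i)) g ⟩
      sumTo (suc n) (λ i → K * (w i * weightAfter n i)) + sumTo (suc n) g
        ≈⟨ +-cong (sym (sumTo-*ˡ (suc n) (λ i → w i * weightAfter n i) K)) refl ⟩
      weight (suc n) + sumTo (suc n) g
        ≡⟨ ≡.cong (λ m → weight (suc n) + sumTo m g) (≡.sym (ℕ.m+[n∸m]≡n l≤)) ⟩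
      weight (suc n) + sumTo (l ℕ.+ (suc n ∸ l)) g
        ≈⟨ +-cong refl (sumTo-split l (suc n ∸ l) g) ⟩
      weight (suc n) + (sumTo l g + sumTo (suc n ∸ l) (λ r → g (l ℕ.+ r)))
        ≈⟨ +-cong refl (trans (+-cong (sumTo-≈0 l g (λ i i<l → ascentCorrection-< l i _ i<l)) refl) (+-identityˡ _)) ⟩
      weight (suc n) + sumTo (suc n ∸ l) (λ r → g (l ℕ.+ r))
        ≈⟨ +-cong refl (sumTo-cong (suc n ∸ l) (λ r → ascentCorrection-≥ l r _)) ⟩
      weight (suc n) + sumTo (suc n ∸ l) (λ r → cc * (w (l ℕ.+ r) * weightAfter n (l ℕ.+ r)))
        ≈⟨ +-cong refl (sym (sumTo-*ˡ (suc n ∸ l) (λ r → w (l ℕ.+ r) * weightAfter n (l ℕ.+ r)) cc)) ⟩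
      weight (suc n) + cc * sumTo (suc n ∸ l) (λ r → w (l ℕ.+ r) * weightAfter n (l ℕ.+ r)) ∎
      where
      w g : ℕ → Carrier
      w i = q ^ i * p ^ (n ∸ i)
      g i = ascentCorrection l i * (w i * weightAfter n i)
      split : ∀ i → w i * (stepFactor l i * weightAfter n i) ≈ K * (w i * weightAfter n i) + g i
      split i = trans (*-cong refl (*-cong (stepFactor-split l i) refl))
        (solve 4 (λ w y k b → w :* ((k :+ b) :* y) := k :* (w :* y) :+ b :* (w :* y)) refl _ _ _ _)

    prefixTerm : ℕ → ℕ → ℕ → Carrier
    prefixTerm N l j = cc ^ j * (q ^ (l ℕ.* j) * (pqChoose (N ∸ l) j * weight (N ∸ j)))

    -- Unfolding weightAfter along the maximal run of ascents at the front: a run of j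
    -- letters above the predecessor contributes cc ^ j and is followed by a fresh start.
    weightAfter-expansion : ∀ N l → l ≤ N → weightAfter N l ≈ sumTo (suc (N ∸ l)) (prefixTerm N l)
    weightAfter-expansion zero    zero z≤n =
      sym (trans (+-identityʳ _) (trans (*-identityˡ _) (trans (*-identityˡ _) (*-identityˡ _))))
    weightAfter-expansion (suc n) l l≤ = begin
      weightAfter (suc n) l
        ≈⟨ weightAfter-suc n l l≤ ⟩
      weight (suc n) + cc * sumTo h (λ r → W r * weightAfter n (l ℕ.+ r))
        ≈⟨ +-congˡ (*-congˡ (sumTo-cong< h (λ r r<h → *-congˡ (padded r r<h)))) ⟩
      weight (suc n) + cc * sumTo h (λ r → W r * sumTo h (prefixTerm n (l ℕ.+ r)))
        ≈⟨ +-congˡ (trans (sumTo-*ˡ h _ cc) (sumTo-cong h (λ r → trans (*-congˡ (sumTo-*ˡ h _ (W r))) (sumTo-*ˡ h _ cc)))) ⟩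
      weight (suc n) + sumTo h (λ r → sumTo h (λ j → cc * (W r * prefixTerm n (l ℕ.+ r) j)))
        ≈⟨ +-congˡ (sumTo-swap h h _) ⟩
      weight (suc n) + sumTo h (λ j → sumTo h (λ r → cc * (W r * prefixTerm n (l ℕ.+ r) j)))
        ≈⟨ +-congˡ (sumTo-cong h (λ j → sumTo-cong< h (λ r r<h → absorb r j r<h))) ⟩
      weight (suc n) + sumTo h (λ j → sumTo h (λ r → cc ^ suc j * (q ^ (l ℕ.* suc j) * (V r j * weight (n ∸ j)))))
        ≈⟨ +-congˡ (sumTo-cong h (λ j → sym (trans (*-congˡ (trans (*-congˡ (sumTo-*ʳ h _ _)) (sumTo-*ˡ h _ _))) (sumTo-*ˡ h _ _)))) ⟩
      weight (suc n) + sumTo h (λ j → prefixTerm (suc n) l (suc j))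
        ≈⟨ +-congʳ (sym prefixTerm-0) ⟩
      sumTo (suc h) (prefixTerm (suc n) l) ∎
      where
      h : ℕ
      h = suc n ∸ l
      W : ℕ → Carrier
      W r = q ^ (l ℕ.+ r) * p ^ (n ∸ (l ℕ.+ r))
      V : ℕ → ℕ → Carrier
      V r j = (q ^ r * p ^ (h ∸ suc r)) * (q ^ (r ℕ.* j) * pqChoose (h ∸ suc r) j)
      n∸[l+r]≡h∸[1+r] : ∀ r → n ∸ (l ℕ.+ r) ≡ h ∸ suc r
      n∸[l+r]≡h∸[1+r] r = ≡.trans (≡.cong (suc n ∸_) (≡.sym (ℕ.+-suc l r))) (≡.sym (ℕ.∸-+-assoc (suc n) l (suc r)))
      l+r≤n : ∀ r → r < h → l ℕ.+ r ≤ n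
      l+r≤n r r<h = ℕ.≤-pred (ℕ.≤-trans (ℕ.≤-reflexive (≡.sym (ℕ.+-suc l r)))
        (ℕ.≤-trans (ℕ.+-monoʳ-≤ l r<h) (ℕ.≤-reflexive (ℕ.m+[n∸m]≡n l≤))))
      -- the extra terms have j > n ∸ (l + r) and vanish with pqChoose
      padded : ∀ r → r < h → weightAfter n (l ℕ.+ r) ≈ sumTo h (prefixTerm n (l ℕ.+ r))
      padded r r<h = trans (weightAfter-expansion n (l ℕ.+ r) (l+r≤n r r<h))
        (sumTo-extend (suc (n ∸ (l ℕ.+ r))) h _
          (ℕ.≤-trans (ℕ.≤-reflexive (≡.cong suc (n∸[l+r]≡h∸[1+r] r)))
            (ℕ.≤-trans (ℕ.≤-reflexive (≡.sym (ℕ.+-∸-assoc 1 r<h))) (ℕ.m∸n≤m h r)))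
          (λ j j> → trans (*-congˡ (*-congˡ (trans (*-congʳ (pqChoose-vanishes j>)) (zeroˡ _))))
                     (trans (*-congˡ (zeroʳ _)) (zeroʳ _))))
      absorb : ∀ r j → r < h → cc * (W r * prefixTerm n (l ℕ.+ r) j)
               ≈ cc ^ suc j * (q ^ (l ℕ.* suc j) * (V r j * weight (n ∸ j)))
      absorb r j r<h rewrite n∸[l+r]≡h∸[1+r] r = begin
        cc * ((q ^ (l ℕ.+ r) * p ^ e) * (cc ^ j * (q ^ ((l ℕ.+ r) ℕ.* j) * (B * X))))
          ≈⟨ *-congˡ (*-cong (*-congʳ (pow-+ q l r)) (*-congˡ (*-congʳ q^[l+r]j))) ⟩
        cc * ((q ^ l * q ^ r * p ^ e) * (cc ^ j * ((q ^ (l ℕ.* j) * q ^ (r ℕ.* j)) * (B * X))))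
          ≈⟨ solve 9 (λ c ql qr pe cj qlj qrj t x →
                c :* ((ql :* qr :* pe) :* (cj :* ((qlj :* qrj) :* (t :* x))))
             := (c :* cj) :* ((ql :* qlj) :* (((qr :* pe) :* (qrj :* t)) :* x)))
             refl cc (q ^ l) (q ^ r) (p ^ e) (cc ^ j) (q ^ (l ℕ.* j)) (q ^ (r ℕ.* j)) B X ⟩
        cc ^ suc j * ((q ^ l * q ^ (l ℕ.* j)) * (((q ^ r * p ^ e) * (q ^ (r ℕ.* j) * B)) * X))
          ≈⟨ *-congˡ (*-congʳ (sym q^l[1+j])) ⟩
        cc ^ suc j * (q ^ (l ℕ.* suc j) * (((q ^ r * p ^ e) * (q ^ (r ℕ.* j) * B)) * X)) ∎
        where
        e = h ∸ suc r
        B = pqChoose e j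
        X = weight (n ∸ j)
        q^[l+r]j : q ^ ((l ℕ.+ r) ℕ.* j) ≈ q ^ (l ℕ.* j) * q ^ (r ℕ.* j)
        q^[l+r]j = trans (reflexive (≡.cong (q ^_) (ℕ.*-distribʳ-+ j l r))) (pow-+ q (l ℕ.* j) (r ℕ.* j))
        q^l[1+j] : q ^ (l ℕ.* suc j) ≈ q ^ l * q ^ (l ℕ.* j)
        q^l[1+j] = trans (reflexive (≡.cong (q ^_) (ℕ.*-suc l j))) (pow-+ q l (l ℕ.* j))
      prefixTerm-0 : prefixTerm (suc n) l 0 ≈ weight (suc n)
      prefixTerm-0 = trans (*-identityˡ _) (trans (*-congʳ (reflexive (≡.cong (q ^_) (ℕ.*-zeroʳ l))))
        (trans (*-identityˡ _) (*-identityˡ _)))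

    weight-recurrence : ∀ n → let N = suc n in
      weight N ≈ K * weight N + K * sumTo N (λ j → prefixTerm N 0 (suc j))
    weight-recurrence n = begin
      weight N                                                               ≈⟨ weight-suc n ⟩
      K * weightAfter N 0                                                    ≈⟨ *-congˡ (weightAfter-expansion N 0 z≤n) ⟩
      K * (prefixTerm N 0 0 + sumTo N (λ j → prefixTerm N 0 (suc j)))        ≈⟨ distribˡ K _ _ ⟩
      K * prefixTerm N 0 0 + K * sumTo N (λ j → prefixTerm N 0 (suc j))     ≈⟨ +-congʳ (*-congˡ prefixTerm-N-0-0) ⟩
      K * weight N + K * sumTo N (λ j → prefixTerm N 0 (suc j))             ∎
      where
      N = suc n
      prefixTerm-N-0-0 : prefixTerm N 0 0 ≈ weight N
      prefixTerm-N-0-0 = trans (*-identityˡ _) (trans (*-identityˡ _) (*-identityˡ _))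

    weight-cancel : ∀ m → K ≈ 1# + m → ∀ n → let N = suc n in
      weight N * m + K * sumTo N (λ j → prefixTerm N 0 (suc j)) ≈ 0#
    weight-cancel m K≈1+m n = begin
      weight N * m + K * Σ
        ≈⟨ sym (+-identityʳ _) ⟩
      (weight N * m + K * Σ) + 0#
        ≈⟨ +-congˡ (sym (-‿inverseʳ (K * weight N))) ⟩
      (weight N * m + K * Σ) + (K * weight N + - (K * weight N))
        ≈⟨ solve 4 (λ am ks ka nka → (am :+ ks) :+ (ka :+ nka) := (am :+ (ka :+ ks)) :+ nka)
             refl (weight N * m) (K * Σ) (K * weight N) (- (K * weight N)) ⟩
      (weight N * m + (K * weight N + K * Σ)) + - (K * weight N)
        ≈⟨ +-congʳ (+-congˡ (sym (weight-recurrence n))) ⟩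
      (weight N * m + weight N) + - (K * weight N)
        ≈⟨ +-congʳ (trans (solve 2 (λ a m → a :* m :+ a := (con 1 :+ m) :* a) refl (weight N) m) (*-congʳ (sym K≈1+m))) ⟩
      K * weight N + - (K * weight N)
        ≈⟨ -‿inverseʳ _ ⟩
      0# ∎
      where
      N = suc n
      Σ = sumTo N (λ j → prefixTerm N 0 (suc j))

    module _ (finv : ℕ → Carrier) (finv-inverse : ∀ n → finv n * [ n ]! ≈ 1#) where

      pqChoose≈ : ∀ N j → j ≤ N → pqChoose N j ≈ (p ^ (j C 2) * [ N ]!) * (finv j * finv (N ∸ j))
      pqChoose≈ N j j≤N = begin
        pqChoose N j
          ≈⟨ sym (*-identityʳ _) ⟩
        pqChoose N j * 1#
          ≈⟨ *-congˡ (sym (trans (*-cong (finv-inverse j) (finv-inverse (N ∸ j))) (*-identityˡ _))) ⟩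
        pqChoose N j * ((finv j * [ j ]!) * (finv (N ∸ j) * [ N ∸ j ]!))
          ≈⟨ solve 5 (λ t a b c d → t :* ((a :* b) :* (c :* d)) := (t :* (b :* d)) :* (a :* c)) refl _ _ _ _ _ ⟩
        (pqChoose N j * ([ j ]! * [ N ∸ j ]!)) * (finv j * finv (N ∸ j))
          ≈⟨ *-congʳ (pqChoose*qfact N j j≤N) ⟩
        (p ^ (j C 2) * [ N ]!) * (finv j * finv (N ∸ j)) ∎

      finv*prefixTerm : ∀ N j → j ≤ N →
        finv N * (K * prefixTerm N 0 j) ≈ (finv (N ∸ j) * weight (N ∸ j)) * (K * (p ^ (j C 2) * (cc ^ j * finv j)))
      finv*prefixTerm N j j≤N = begin
        finv N * (K * (cc ^ j * (1# * (pqChoose N j * weight (N ∸ j)))))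
          ≈⟨ *-congˡ (*-congˡ (*-congˡ (*-congˡ (*-congʳ (pqChoose≈ N j j≤N))))) ⟩
        finv N * (K * (cc ^ j * (1# * (((p ^ (j C 2) * [ N ]!) * (finv j * finv (N ∸ j))) * weight (N ∸ j)))))
          ≈⟨ solve 9 (λ fN k cj o cp qN fj fd a →
                fN :* (k :* (cj :* (o :* (((cp :* qN) :* (fj :* fd)) :* a))))
                := (fN :* qN) :* (o :* ((fd :* a) :* (k :* (cp :* (cj :* fj))))))
              refl (finv N) K (cc ^ j) 1# (p ^ (j C 2)) [ N ]! (finv j) (finv (N ∸ j)) (weight (N ∸ j)) ⟩
        (finv N * [ N ]!) * (1# * ((finv (N ∸ j) * weight (N ∸ j)) * (K * (p ^ (j C 2) * (cc ^ j * finv j)))))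
          ≈⟨ trans (*-congʳ (finv-inverse N)) (trans (*-identityˡ _) (*-identityˡ _)) ⟩
        (finv (N ∸ j) * weight (N ∸ j)) * (K * (p ^ (j C 2) * (cc ^ j * finv j))) ∎

      weight-exponential-identity : ∀ m → K ≈ 1# + m →
        (f g : ℕ → Carrier) → (∀ i → f i ≈ finv i * weight i) → g 0 ≈ m →
        (∀ j → g (suc j) ≈ K * (p ^ (suc j C 2) * (cc ^ suc j * finv (suc j)))) →
        ∀ N → sumTo (suc N) (λ i → f i * g (N ∸ i)) ≈ const R m N
      weight-exponential-identity m K≈1+m f g f≈ g0≈ gsuc≈ zero =
        trans (+-identityʳ _) (trans (*-cong (trans (f≈ 0) (trans (*-identityʳ _) finv0≈1)) g0≈) (*-identityˡ _))
        where
        finv0≈1 : finv 0 ≈ 1#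
        finv0≈1 = trans (sym (*-identityʳ _)) (finv-inverse 0)
      weight-exponential-identity m K≈1+m f g f≈ g0≈ gsuc≈ (suc n) = begin
        sumTo (suc N) (λ i → f i * g (N ∸ i))
          ≈⟨ sumTo-reverse (suc N) (λ i → f i * g (N ∸ i)) ⟩
        sumTo (suc N) (λ j → f (N ∸ j) * g (N ∸ (N ∸ j)))
          ≈⟨ sumTo-cong< (suc N) {λ j → f (N ∸ j) * g (N ∸ (N ∸ j))}
               (λ j j≤N → *-congˡ (reflexive (≡.cong g (ℕ.m∸[m∸n]≡n (ℕ.≤-pred j≤N))))) ⟩
        f N * g 0 + sumTo N (λ j → f (N ∸ suc j) * g (suc j))
          ≈⟨ +-cong (*-cong (f≈ N) g0≈)
                    (sumTo-cong< N (λ j j<N → trans (*-cong (f≈ (N ∸ suc j)) (gsuc≈ j)) (sym (finv*prefixTerm N (suc j) j<N)))) ⟩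
        (finv N * weight N) * m + sumTo N (λ j → finv N * (K * prefixTerm N 0 (suc j)))
          ≈⟨ +-congˡ (trans (sym (sumTo-*ˡ N (λ j → K * prefixTerm N 0 (suc j)) (finv N)))
                            (*-congˡ (sym (sumTo-*ˡ N (λ j → prefixTerm N 0 (suc j)) K)))) ⟩
        (finv N * weight N) * m + finv N * (K * Σ)
          ≈⟨ solve 4 (λ f a m s → (f :* a) :* m :+ f :* s := f :* (a :* m :+ s)) refl (finv N) (weight N) m (K * Σ) ⟩
        finv N * (weight N * m + K * Σ)
          ≈⟨ *-congˡ (weight-cancel m K≈1+m n) ⟩
        finv N * 0#
          ≈⟨ zeroʳ _ ⟩
        0# ∎
        where
        N = suc n
        Σ = sumTo N (λ j → prefixTerm N 0 (suc j))

module Arrangements {c ℓ : Level} (R : CommutativeRing c ℓ) (p q : CommutativeRing.Carrier R) (k : ℕ) where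
  open CommutativeRing R
  open RingSums R
  open Recurrences R p q (fromℕ R k)
  open import Relation.Binary.Reasoning.Setoid setoid
  open import Algebra.Solver.Ring.NaturalCoefficients.Default commutativeSemiring
    using (solve; _:=_; _:*_)

  K : Carrier
  K = fromℕ R k

  invWeight : List ℕ → Carrier
  invWeight σ = q ^ invL σ * p ^ coinvL σ

  -- The number of colourings w of σ with dmch = 0 once a preceding letter b has a fixed colour.
  extendCount : ℕ → List ℕ → Carrier
  extendCount b []      = 1#
  extendCount b (y ∷ σ) = (if b <ᵇ y then 1# else K) * extendCount y σ

  colourCount : List ℕ → Carrier
  colourCount []      = 1#
  colourCount (x ∷ σ) = K * extendCount x σ

  arrangementSum : ℕ → List ℕ → (List ℕ → Carrier) → Carrier
  arrangementSum zero    L f = f []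
  arrangementSum (suc m) L f = sumR R (map (λ x → arrangementSum m (delete x L) (λ τ → f (x ∷ τ))) L)

  SameCounts : List ℕ → List ℕ → Set
  SameCounts τ L = ∀ P → count P τ ≡ count P L

  arrangementSum-cong : ∀ m L {f g : List ℕ → Carrier} → Increasing L → length L ≡ m →
    (∀ τ → SameCounts τ L → f τ ≈ g τ) → arrangementSum m L f ≈ arrangementSum m L g
  arrangementSum-cong zero    []     inc ≡.refl f≈g = f≈g [] (λ _ → ≡.refl)
  arrangementSum-cong (suc m) L {f} {g} inc |L| f≈g = sumR-cong-∈ L (λ x x∈L →
    arrangementSum-cong m (delete x L) (Increasing-delete x inc) (ℕ.suc-injective (≡.trans (≡.sym (length-delete inc x∈L)) |L|))
      (λ τ τ~ → f≈g (x ∷ τ) (λ P → ≡.trans (≡.cong ((if P x then 1 else 0) ℕ.+_) (τ~ P)) (≡.sym (count-delete P inc x∈L)))))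

  arrangementSum-*ˡ : ∀ m L (f : List ℕ → Carrier) a → arrangementSum m L (λ τ → a * f τ) ≈ a * arrangementSum m L f
  arrangementSum-*ˡ zero    L f a = refl
  arrangementSum-*ˡ (suc m) L f a =
    trans (sumR-cong L (λ x → arrangementSum-*ˡ m (delete x L) (λ τ → f (x ∷ τ)) a))
          (sym (sumR-*ˡ L (λ x → arrangementSum m (delete x L) (λ τ → f (x ∷ τ))) a))

  sumR-byRank : ∀ {L} → Increasing L → (g : ℕ → Carrier) → sumR R (map (λ x → g (below x L)) L) ≈ sumTo (length L) g
  sumR-byRank []                   g = refl
  sumR-byRank {y ∷ L} (y<L ∷ inc) g = +-cong (reflexive (≡.cong g (below-head y<L)))
    (trans (sumR-cong-∈ L (λ x x∈L → reflexive (≡.cong g (below-∷ x∈L)))) (sumR-byRank inc (λ i → g (suc i))))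
    where
    below-∷ : ∀ {x} → x ∈ L → below x (y ∷ L) ≡ suc (below x L)
    below-∷ x∈L rewrite <⇒<ᵇ≡true (All.lookup y<L x∈L) = ≡.refl

  invWeight-∷ : ∀ {L x τ m} → Increasing L → x ∈ L → length L ≡ suc m → SameCounts τ (delete x L) →
    invWeight (x ∷ τ) ≈ (q ^ below x L * p ^ (m ∸ below x L)) * invWeight τ
  invWeight-∷ {L} {x} {τ} {m} inc x∈L |L| τ~ = begin
    q ^ (below x τ ℕ.+ invL τ) * p ^ (above x τ ℕ.+ coinvL τ)
      ≈⟨ *-cong (pow-+ q (below x τ) (invL τ)) (pow-+ p (above x τ) (coinvL τ)) ⟩
    (q ^ below x τ * q ^ invL τ) * (p ^ above x τ * p ^ coinvL τ)
      ≈⟨ solve 4 (λ a b c d → (a :* b) :* (c :* d) := (a :* c) :* (b :* d)) refl _ _ _ _ ⟩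
    (q ^ below x τ * p ^ above x τ) * invWeight τ
      ≡⟨ ≡.cong₂ (λ i j → (q ^ i * p ^ j) * invWeight τ) (unchanged _ x≮x) (≡.trans (unchanged _ x≮x) above≡) ⟩
    (q ^ below x L * p ^ (m ∸ below x L)) * invWeight τ ∎
    where
    x≮x : (x <ᵇ x) ≡ false
    x≮x = ≥⇒<ᵇ≡false (ℕ.≤-refl {x})
    unchanged : ∀ P → P x ≡ false → count P τ ≡ count P L
    unchanged P Px≡false = ≡.trans (τ~ P) (≡.sym (≡.trans (count-delete P inc x∈L)
      (≡.cong (λ b → (if b then 1 else 0) ℕ.+ count P (delete x L)) Px≡false)))
    above≡ : above x L ≡ m ∸ below x L
    above≡ = ≡.sym (≡.trans (≡.cong (_∸ below x L) (ℕ.suc-injective (≡.trans (≡.sym |L|) (≡.sym (below+above inc x∈L)))))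
                            (ℕ.m+n∸m≡n (below x L) (above x L)))

  mutual
    arrangementSum-extendCount : ∀ m L b → Increasing L → length L ≡ m →
      arrangementSum m L (λ τ → invWeight τ * extendCount b τ) ≈ weightAfter m (atMost b L)
    arrangementSum-extendCount zero    []  b inc ≡.refl = trans (*-identityʳ _) (*-identityˡ _)
    arrangementSum-extendCount (suc m) L   b inc |L|    =
      sumByFirstLetter m L (λ x → if b <ᵇ x then 1# else K) (stepFactor (atMost b L)) inc |L|
        (λ x x∈L → reflexive (≡.cong (λ c → if c then 1# else K) (<ᵇ≡atMost≤ᵇbelow b inc x∈L)))

    sumByFirstLetter : ∀ m L (h : ℕ → Carrier) (h′ : ℕ → Carrier) → Increasing L → length L ≡ suc m →
      (∀ x → x ∈ L → h x ≈ h′ (below x L)) →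
      sumR R (map (λ x → arrangementSum m (delete x L) (λ τ → invWeight (x ∷ τ) * (h x * extendCount x τ))) L)
        ≈ sumTo (suc m) (λ i → (q ^ i * p ^ (m ∸ i)) * (h′ i * weightAfter m i))
    sumByFirstLetter m L h h′ inc |L| h≈h′ = begin
      sumR R (map (λ x → arrangementSum m (delete x L) (λ τ → invWeight (x ∷ τ) * (h x * extendCount x τ))) L)
        ≈⟨ sumR-cong-∈ L byLetter ⟩
      sumR R (map (λ x → G (below x L)) L)
        ≈⟨ sumR-byRank inc G ⟩
      sumTo (length L) G
        ≡⟨ ≡.cong (λ n → sumTo n G) |L| ⟩
      sumTo (suc m) G ∎
      where
      G : ℕ → Carrier
      G i = (q ^ i * p ^ (m ∸ i)) * (h′ i * weightAfter m i)
      byLetter : ∀ x → x ∈ L → arrangementSum m (delete x L) (λ τ → invWeight (x ∷ τ) * (h x * extendCount x τ)) ≈ G (below x L)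
      byLetter x x∈L = begin
        arrangementSum m (delete x L) (λ τ → invWeight (x ∷ τ) * (h x * extendCount x τ))
          ≈⟨ arrangementSum-cong m (delete x L) inc′ |L′| (λ τ τ~ → trans (*-congʳ (invWeight-∷ {τ = τ} inc x∈L |L| τ~))
               (solve 4 (λ w v a t → (w :* v) :* (a :* t) := w :* (a :* (v :* t))) refl _ _ _ _)) ⟩
        arrangementSum m (delete x L) (λ τ → W * (h x * (invWeight τ * extendCount x τ)))
          ≈⟨ trans (arrangementSum-*ˡ m (delete x L) _ W) (*-congˡ (arrangementSum-*ˡ m (delete x L) _ (h x))) ⟩
        W * (h x * arrangementSum m (delete x L) (λ τ → invWeight τ * extendCount x τ))
          ≈⟨ *-congˡ (*-cong (h≈h′ x x∈L) (trans (arrangementSum-extendCount m (delete x L) x inc′ |L′|)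
                                                 (reflexive (≡.cong (weightAfter m) (atMost-delete x L))))) ⟩
        G (below x L) ∎
        where
        W = q ^ below x L * p ^ (m ∸ below x L)
        inc′ = Increasing-delete x inc
        |L′| = ℕ.suc-injective (≡.trans (≡.sym (length-delete inc x∈L)) |L|)

  arrangementSum-colourCount : ∀ m L → Increasing L → length L ≡ m →
    arrangementSum m L (λ σ → invWeight σ * colourCount σ) ≈ weight m
  arrangementSum-colourCount zero    []  inc ≡.refl = trans (*-identityʳ _) (*-identityˡ _)
  arrangementSum-colourCount (suc m) L   inc |L|    = begin
    arrangementSum (suc m) L (λ σ → invWeight σ * colourCount σ)
      ≈⟨ sumByFirstLetter m L (λ _ → K) (λ _ → K) inc |L| (λ _ _ → refl) ⟩
    sumTo (suc m) (λ i → (q ^ i * p ^ (m ∸ i)) * (K * weightAfter m i))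
      ≈⟨ sumTo-cong (suc m) (λ i → solve 3 (λ w a y → w :* (a :* y) := a :* (w :* y)) refl (q ^ i * p ^ (m ∸ i)) K (weightAfter m i)) ⟩
    sumTo (suc m) (λ i → K * ((q ^ i * p ^ (m ∸ i)) * weightAfter m i))
      ≈⟨ sym (sumTo-*ˡ (suc m) (λ i → (q ^ i * p ^ (m ∸ i)) * weightAfter m i) K) ⟩
    weight (suc m) ∎

  sumR-allVecs-suc : ∀ n m (h : List ℕ → Carrier) →
    sumR R (map (λ v → h (line v)) (allVecs n (suc m)))
      ≈ sumTo n (λ i → sumR R (map (λ w → h (i ∷ line w)) (allVecs n m)))
  sumR-allVecs-suc n m h = begin
    sumR R (map (λ v → h (line v)) (allVecs n (suc m)))
      ≈⟨ sumR-concatMap (λ v → h (line v)) (λ i → map (i ∷ᵥ_) (allVecs n m)) (allFin n) ⟩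
    sumR R (map (λ i → sumR R (map (λ v → h (line v)) (map (i ∷ᵥ_) (allVecs n m)))) (allFin n))
      ≈⟨ sumR-cong (allFin n) (λ i → sumR-map-map (λ v → h (line v)) (i ∷ᵥ_) (allVecs n m)) ⟩
    sumR R (map (λ i → g (toℕ i)) (allFin n))
      ≈⟨ sumR-allFin n g ⟩
    sumTo n g ∎
    where
    g : ℕ → Carrier
    g i = sumR R (map (λ w → h (i ∷ line w)) (allVecs n m))

  zeroDmch : ℕ → Carrier → Carrier
  zeroDmch d x = if d ≡ᵇ 0 then x else 0#

  sumR-zeroDmch-∷ : ∀ {m} b d e x (ws : List (Vec (Fin k) m)) (D : Vec (Fin k) m → ℕ) →
    sumR R (map (λ w → zeroDmch ((if b ∧ not (d ≡ᵇ e) then 1 else 0) ℕ.+ D w) x) ws)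
      ≈ (if b ∧ not (d ≡ᵇ e) then 0# else sumR R (map (λ w → zeroDmch (D w) x) ws))
  sumR-zeroDmch-∷ b d e x ws D with b ∧ not (d ≡ᵇ e)
  ... | true  = sumR-≈0 ws (λ _ → refl)
  ... | false = refl

  sumTo-colour : ∀ b d x y → d < k →
    sumTo k (λ e → if b ∧ not (d ≡ᵇ e) then 0# else y * x) ≈ ((if b then 1# else K) * y) * x
  sumTo-colour true  d x y d<k = trans (sumTo-indicator k d (y * x) d<k) (*-congʳ (sym (*-identityˡ y)))
  sumTo-colour false d x y d<k = trans (sumTo-const k (y * x)) (sym (*-assoc _ _ _))

  sumR-colourings-after : ∀ x r d → d < k → ∀ m → length r ≡ m → ∀ X →
    sumR R (map (λ w → zeroDmch (dmchL (x ∷ r) (d ∷ line w)) X) (allVecs k m)) ≈ extendCount x r * X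
  sumR-colourings-after x []      d d<k zero    ≡.refl X = trans (+-identityʳ X) (sym (*-identityˡ X))
  sumR-colourings-after x (y ∷ r) d d<k (suc m) |r|    X = begin
    sumR R (map (λ w → zeroDmch (dmchL (x ∷ y ∷ r) (d ∷ line w)) X) (allVecs k (suc m)))
      ≈⟨ sumR-allVecs-suc k m (λ l → zeroDmch (dmchL (x ∷ y ∷ r) (d ∷ l)) X) ⟩
    sumTo k (λ e → sumR R (map (λ w → zeroDmch (dmchL (x ∷ y ∷ r) (d ∷ e ∷ line w)) X) (allVecs k m)))
      ≈⟨ sumTo-cong< k (λ e e<k → trans (sumR-zeroDmch-∷ (x <ᵇ y) d e X (allVecs k m) (λ w → dmchL (y ∷ r) (e ∷ line w)))
                                    (if-congᶠ ((x <ᵇ y) ∧ not (d ≡ᵇ e)) (sumR-colourings-after y r e e<k m (ℕ.suc-injective |r|) X))) ⟩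
    sumTo k (λ e → if (x <ᵇ y) ∧ not (d ≡ᵇ e) then 0# else extendCount y r * X)
      ≈⟨ sumTo-colour (x <ᵇ y) d X (extendCount y r) d<k ⟩
    extendCount x (y ∷ r) * X ∎
    where
    if-congᶠ : ∀ b {z u v} → u ≈ v → (if b then z else u) ≈ (if b then z else v)
    if-congᶠ true  _   = refl
    if-congᶠ false u≈v = u≈v

  sumR-colourings : ∀ σ m → length σ ≡ m → ∀ X →
    sumR R (map (λ w → zeroDmch (dmchL σ (line w)) X) (allVecs k m)) ≈ colourCount σ * X
  sumR-colourings []      zero    ≡.refl X = trans (+-identityʳ X) (sym (*-identityˡ X))
  sumR-colourings (x ∷ r) (suc m) |σ|    X = begin
    sumR R (map (λ w → zeroDmch (dmchL (x ∷ r) (line w)) X) (allVecs k (suc m)))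
      ≈⟨ sumR-allVecs-suc k m (λ l → zeroDmch (dmchL (x ∷ r) l) X) ⟩
    sumTo k (λ d → sumR R (map (λ w → zeroDmch (dmchL (x ∷ r) (d ∷ line w)) X) (allVecs k m)))
      ≈⟨ sumTo-cong< k (λ d d<k → sumR-colourings-after x r d d<k m (ℕ.suc-injective |σ|) X) ⟩
    sumTo k (λ _ → extendCount x r * X)
      ≈⟨ trans (sumTo-const k _) (sym (*-assoc _ _ _)) ⟩
    colourCount (x ∷ r) * X ∎

  sumR-distinctAvoiding : ∀ n m E (f : List ℕ → Carrier) →
    sumR R (map (λ v → if distinctAvoiding E (line v) then f (line v) else 0#) (allVecs n m))
      ≈ arrangementSum m (filterᵇ (avoid E) (upTo n)) f
  sumR-distinctAvoiding n zero    E f = +-identityʳ _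
  sumR-distinctAvoiding n (suc m) E f = begin
    sumR R (map (λ v → if distinctAvoiding E (line v) then f (line v) else 0#) (allVecs n (suc m)))
      ≈⟨ sumR-allVecs-suc n m (λ l → if distinctAvoiding E l then f l else 0#) ⟩
    sumTo n g
      ≈⟨ sumTo-cong n byFirst ⟩
    sumTo n g′
      ≈⟨ sym (sumR-upTo g′ n) ⟩
    sumR R (map g′ (upTo n))
      ≈⟨ sym (sumR-filterᵇ (avoid E) (λ x → arrangementSum m (delete x L) (λ τ → f (x ∷ τ))) (upTo n)) ⟩
    arrangementSum (suc m) L f ∎
    where
    L = filterᵇ (avoid E) (upTo n)
    g g′ : ℕ → Carrier
    g  x = sumR R (map (λ w → if distinctAvoiding E (x ∷ line w) then f (x ∷ line w) else 0#) (allVecs n m))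
    g′ x = if avoid E x then arrangementSum m (delete x L) (λ τ → f (x ∷ τ)) else 0#
    byFirst : ∀ x → g x ≈ g′ x
    byFirst x = trans (sumR-cong (allVecs n m) (λ w → reflexive (≡.cong (λ b → if b then f (x ∷ line w) else 0#)
                                                                (distinctAvoiding-∷ E x (line w)))))
                      (split (avoid E x))
      where
      split : ∀ b → sumR R (map (λ w → if b ∧ distinctAvoiding (x ∷ E) (line w) then f (x ∷ line w) else 0#) (allVecs n m))
                  ≈ (if b then arrangementSum m (delete x L) (λ τ → f (x ∷ τ)) else 0#)
      split true  = trans (sumR-distinctAvoiding n m (x ∷ E) (λ τ → f (x ∷ τ)))
                          (reflexive (≡.cong (λ L′ → arrangementSum m L′ (λ τ → f (x ∷ τ))) (≡.sym (delete-avoiding x E (upTo n)))))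
      split false = sumR-≈0 (allVecs n m) (λ _ → refl)

  length-line : ∀ {a n} (v : Vec (Fin a) n) → length (line v) ≡ n
  length-line []ᵥ       = ≡.refl
  length-line (x ∷ᵥ v) = ≡.cong suc (length-line v)

  dmchZeroSum≈weight : ∀ n → dmchZeroSum R p q k n ≈ weight n
  dmchZeroSum≈weight n = begin
    dmchZeroSum R p q k n
      ≈⟨ sumR-concatMap h (λ σ → map (σ ,_) (allVecs k n)) (perms n) ⟩
    sumR R (map (λ σ → sumR R (map h (map (σ ,_) (allVecs k n)))) (perms n))
      ≈⟨ sumR-cong (perms n) (λ σ → trans (sumR-map-map h (σ ,_) (allVecs k n))
           (trans (sumR-colourings (line σ) n (length-line σ) (invWeight (line σ))) (*-comm _ _))) ⟩
    sumR R (map (λ σ → F (line σ)) (perms n))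
      ≈⟨ sumR-filterᵇ (λ v → distinctᵇ (line v)) (λ σ → F (line σ)) (allVecs n n) ⟩
    sumR R (map (λ v → if distinctᵇ (line v) then F (line v) else 0#) (allVecs n n))
      ≈⟨ sumR-cong (allVecs n n) (λ v → reflexive (≡.cong (λ b → if b then F (line v) else 0#)
           (≡.sym (distinctAvoiding-[] (line v))))) ⟩
    sumR R (map (λ v → if distinctAvoiding [] (line v) then F (line v) else 0#) (allVecs n n))
      ≈⟨ sumR-distinctAvoiding n n [] F ⟩
    arrangementSum n (filterᵇ (avoid []) (upTo n)) F
      ≡⟨ ≡.cong (λ L → arrangementSum n L F) (filterᵇ-avoid-[] (upTo n)) ⟩
    arrangementSum n (upTo n) F
      ≈⟨ arrangementSum-colourCount n (upTo n) (Increasing-upTo n) (length-upTo n) ⟩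
    weight n ∎
    where
    F : List ℕ → Carrier
    F σ = invWeight σ * colourCount σ
    h : Vec (Fin n) n × Vec (Fin k) n → Carrier
    h (σ , w) = zeroDmch (dmch (σ , w)) (invWeight (line σ))

corollary14 : ∀ {c ℓ : Level} (R : CommutativeRing c ℓ) →
    let open CommutativeRing R in
    (p q : Carrier) (k : ℕ) → 2 ≤ k →
    (finv : ℕ → Carrier) → (∀ n → finv n * qfact R p q n ≈ 1#) →
    (kinv : Carrier) → kinv * fromℕ R (k ∸ 1) ≈ 1# →
    ∀ N → seriesMul R (lhsSeries R p q k finv) (denomSeries R p q k finv) N
            ≈ const R (fromℕ R (k ∸ 1)) N
corollary14 R p q (suc k′) (s≤s _) finv finv-inverse _ _ N =
  trans (sumR-upTo (λ i → lhsSeries R p q k finv i * denomSeries R p q k finv (N ∸ i)) (suc N))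
        (weight-exponential-identity (- m) K+cc≈1 finv finv-inverse m refl
           (lhsSeries R p q k finv) (denomSeries R p q k finv)
           (λ i → *-congˡ (dmchZeroSum≈weight i)) refl (λ _ → refl) N)
  where
  open CommutativeRing R
  open RingSums R
  k = suc k′
  m = fromℕ R k′
  open Recurrences R p q (fromℕ R k)
  open Arrangements R p q k using (dmchZeroSum≈weight)
  K+cc≈1 : (1# + m) + - m ≈ 1#
  K+cc≈1 = trans (+-assoc _ _ _) (trans (+-congˡ (-‿inverseʳ m)) (+-identityʳ _))
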